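{- Let $\mathbb{F}_q$ be a finite field of odd characteristic and let $f\in \mathbb{F}_q[x]$ be a monic quadratic with critical point $\gamma\in \mathbb{F}_q$, written $f(x)=(x-\gamma)^2+\gamma+c$ with $c\in \mathbb{F}_q$; let $b_i=f^i(\gamma)$. (1) If $f$ has orbit type $(2,n)$ for some $n\geq 1$, then $(b_n-\gamma)^2=-2c$. (2) If $f$ has orbit type $(3,1)$, then $(b_1-\gamma)^2(b_2-\gamma)^2 = 2(b_2-\gamma)$ and $(b_1-\gamma)^2+(b_2-\gamma)^2=-2c$.
   Context: $f^k$ denotes the $k$-fold composition of $f$. The orbit type of $f$ is the pair $(m,n)$ of minimal integers $m\geq 0$, $n\geq 1$ such that $f^m(\gamma)=f^{m+n}(\gamma)$. -}

module Defs where

open import Level using (Level; _⊔_) renaming (suc to lsuc)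
open import Algebra.Bundles using (CommutativeRing)
open import Data.Nat using (ℕ; zero; suc; _≤_; _<_) renaming (_+_ to _+ℕ_)
open import Data.Nat.Divisibility using (_∣_)
open import Data.List using (List)
open import Data.List.Relation.Unary.Any using (Any)
open import Data.Product using (Σ; _×_; ∃)
open import Relation.Nullary using (¬_)

record Field (c ℓ : Level) : Set (lsuc (c ⊔ ℓ)) where
  field
    commRing : CommutativeRing c ℓ
  open CommutativeRing commRing public
  field
    0≉1     : ¬ (0# ≈ 1#)
    inverse : ∀ x → ¬ (x ≈ 0#) → Σ Carrier (λ y → x * y ≈ 1#)

record FiniteField (c ℓ : Level) : Set (lsuc (c ⊔ ℓ)) where
  field
    fld : Field c ℓ
  open Field fld public
  field
    elements : List Carrier
    complete : ∀ x → Any (λ y → x ≈ y) elements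

module _ {c ℓ : Level} (F : Field c ℓ) where
  open Field F

  natCast : ℕ → Carrier
  natCast zero    = 0#
  natCast (suc n) = 1# + natCast n

  IsCharacteristic : ℕ → Set ℓ
  IsCharacteristic p =
    (0 < p) × (natCast p ≈ 0#) × (∀ k → 0 < k → k < p → ¬ (natCast k ≈ 0#))

  OddCharacteristic : Set ℓ
  OddCharacteristic = ∃ λ p → IsCharacteristic p × ¬ (2 ∣ p)

  iter : (Carrier → Carrier) → ℕ → Carrier → Carrier
  iter f zero    x = x
  iter f (suc k) x = f (iter f k x)

  OrbitType : (Carrier → Carrier) → Carrier → ℕ → ℕ → Set ℓ
  OrbitType f γ m n =
    (1 ≤ n) × (iter f m γ ≈ iter f (m +ℕ n) γ) ×
    (∀ m' n' → 1 ≤ n' → iter f m' γ ≈ iter f (m' +ℕ n') γ → (m ≤ m') × (n ≤ n'))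

{-# OPTIONS --safe #-}
module Submission where

open import Defs
open import Algebra.Bundles using (CommutativeRing)
open import Data.Nat using (ℕ; suc; _<_; s≤s; z≤n) renaming (_+_ to _+ℕ_)
open import Data.Nat.Properties using (<⇒≱)
open import Data.Product using (_×_; _,_; proj₁; proj₂)
open import Relation.Nullary using (¬_)

-- Writing dᵢ = bᵢ - γ, one has f x - γ = (x - γ)² + c, hence dᵢ₊₁ = dᵢ² + c and d₁ = c.
-- If f u = f v with u ≠ v then (u - γ)² = (v - γ)², so (u - γ) + (v - γ) = 0 because a
-- field has no zero divisors. Minimality of the orbit type gives such a collision at
-- (b₁, b₁₊ₙ) for type (2, n) and at (b₂, b₃) for type (3, 1); both claims are then
-- polynomial consequences of d₁ + d₁₊ₙ = 0, resp. d₂ + d₃ = 0.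

module CommutativeRingIdentities {a ℓ} (R : CommutativeRing a ℓ) where
  open CommutativeRing R
  open import Algebra.Properties.Ring ring using (+-inverseˡ-unique; +-cancelʳ; -‿distribˡ-*)
  open import Algebra.Solver.Ring.NaturalCoefficients.Default commutativeSemiring
  open import Relation.Binary.Reasoning.Setoid setoid

  two : Carrier
  two = 1# + 1#

  two*x≈x+x : ∀ x → two * x ≈ x + x
  two*x≈x+x x = trans (distribʳ x 1# 1#) (+-cong (*-identityˡ x) (*-identityˡ x))

  x+[y+y]≈0⇒x≈-[two*y] : ∀ {x y} → x + (y + y) ≈ 0# → x ≈ - (two * y)
  x+[y+y]≈0⇒x≈-[two*y] {x} {y} eq =
    trans (+-inverseˡ-unique x (y + y) eq) (-‿cong (sym (two*x≈x+x y)))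

  -- The semiring solver knows no negation, so - y enters as a variable w.
  [x-y][x+y]≈x*x-y*y : ∀ x y → (x - y) * (x + y) ≈ x * x - y * y
  [x-y][x+y]≈x*x-y*y x y = begin
    (x - y) * (x + y)               ≈⟨ solve 3 (λ x y w → (x :+ w) :* (x :+ y)
                                         := (x :* x :+ w :* y) :+ x :* (y :+ w)) refl x y (- y) ⟩
    (x * x + - y * y) + x * (y - y) ≈⟨ +-cong (+-congˡ (sym (-‿distribˡ-* y y)))
                                              (trans (*-congˡ (-‿inverseʳ y)) (zeroʳ x)) ⟩
    (x * x - y * y) + 0#            ≈⟨ +-identityʳ _ ⟩
    x * x - y * y                   ∎

  -- c and e play the roles of d₁ and d₂; the hypothesis is d₂ + d₃ ≈ 0.
  critical-relations : ∀ c → let e = c * c + c in e + (e * e + c) ≈ 0# →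
    (c * c) * (e * e) ≈ two * e × c * c + e * e ≈ - (two * c)
  critical-relations c S = product , sum
    where
    e tail : Carrier
    e = c * c + c
    tail = c * c * e + c * c * c

    -- Adding tail turns either side into a multiple of the hypothesis.
    product : (c * c) * (e * e) ≈ two * e
    product = +-cancelʳ tail _ _ (begin
      (c * c) * (e * e) + tail    ≈⟨ solve 1 (λ c → let e = c :* c :+ c in
                                       (c :* c) :* (e :* e) :+ (c :* c :* e :+ c :* c :* c)
                                         := (c :* c) :* (e :+ (e :* e :+ c))) refl c ⟩
      (c * c) * (e + (e * e + c)) ≈⟨ trans (*-congˡ S) (zeroʳ _) ⟩
      0#                          ≈⟨ S ⟨
      e + (e * e + c)             ≈⟨ solve 1 (λ c → let e = c :* c :+ c in
                                       e :+ (e :* e :+ c)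
                                         := (e :+ e) :+ (c :* c :* e :+ c :* c :* c)) refl c ⟩
      (e + e) + tail              ≈⟨ +-congʳ (two*x≈x+x e) ⟨
      two * e + tail              ∎)

    sum : c * c + e * e ≈ - (two * c)
    sum = x+[y+y]≈0⇒x≈-[two*y] (trans
      (solve 2 (λ c e → (c :* c :+ e :* e) :+ (c :+ c) := (c :* c :+ c) :+ (e :* e :+ c)) refl c e)
      S)

module FieldProperties {a ℓ} (F : Field a ℓ) where
  open Field F
  open CommutativeRingIdentities commRing using ([x-y][x+y]≈x*x-y*y)
  open import Algebra.Properties.Ring ring using (x≈y⇒x∙y⁻¹≈ε; x∙y⁻¹≈ε⇒x≈y)
  open import Relation.Binary.Reasoning.Setoid setoid

  x*y≈0⇒y≈0 : ∀ {x y} → ¬ x ≈ 0# → x * y ≈ 0# → y ≈ 0#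
  x*y≈0⇒y≈0 {x} {y} x≉0 xy≈0 with inverse x x≉0
  ... | x⁻¹ , xx⁻¹≈1 = begin
    y              ≈⟨ *-identityˡ y ⟨
    1# * y         ≈⟨ *-congʳ xx⁻¹≈1 ⟨
    (x * x⁻¹) * y  ≈⟨ *-congʳ (*-comm x x⁻¹) ⟩
    (x⁻¹ * x) * y  ≈⟨ *-assoc x⁻¹ x y ⟩
    x⁻¹ * (x * y)  ≈⟨ *-congˡ xy≈0 ⟩
    x⁻¹ * 0#       ≈⟨ zeroʳ x⁻¹ ⟩
    0#             ∎

  x*x≈y*y⇒x+y≈0 : ∀ {x y} → ¬ x ≈ y → x * x ≈ y * y → x + y ≈ 0#
  x*x≈y*y⇒x+y≈0 {x} {y} x≉y xx≈yy = x*y≈0⇒y≈0 (λ x-y≈0 → x≉y (x∙y⁻¹≈ε⇒x≈y x y x-y≈0))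
    (trans ([x-y][x+y]≈x*x-y*y x y) (x≈y⇒x∙y⁻¹≈ε xx≈yy))

  orbitType-noncollision : ∀ {f γ m n m′ n′} → OrbitType F f γ m n → m′ < m → 0 < n′ →
                           ¬ iter F f m′ γ ≈ iter F f (m′ +ℕ n′) γ
  orbitType-noncollision (_ , _ , minimal) m′<m 0<n′ collision =
    <⇒≱ m′<m (proj₁ (minimal _ _ 0<n′ collision))

module CriticalOrbit {a ℓ} (F : Field a ℓ) (γ c : Field.Carrier F) where
  open Field F
  open CommutativeRingIdentities commRing using (two; x+[y+y]≈0⇒x≈-[two*y]; critical-relations)
  open FieldProperties F using (x*x≈y*y⇒x+y≈0; orbitType-noncollision)
  open import Algebra.Properties.Ring ring using (+-cancelʳ)
  open import Algebra.Solver.Ring.NaturalCoefficients.Default commutativeSemiring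
  open import Relation.Binary.Reasoning.Setoid setoid

  f : Carrier → Carrier
  f x = (x - γ) * (x - γ) + γ + c

  b : ℕ → Carrier
  b i = iter F f i γ

  f[x]-γ≈[x-γ]²+c : ∀ x → f x - γ ≈ (x - γ) * (x - γ) + c
  f[x]-γ≈[x-γ]²+c x = begin
    ((s + γ) + c) + - γ ≈⟨ solve 4 (λ s g k w → ((s :+ g) :+ k) :+ w := (s :+ k) :+ (g :+ w))
                                  refl s γ c (- γ) ⟩
    (s + c) + (γ - γ)   ≈⟨ +-congˡ (-‿inverseʳ γ) ⟩
    (s + c) + 0#        ≈⟨ +-identityʳ _ ⟩
    s + c               ∎
    where
    s : Carrier
    s = (x - γ) * (x - γ)

  f[γ]-γ≈c : f γ - γ ≈ c
  f[γ]-γ≈c = begin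
    f γ - γ                  ≈⟨ f[x]-γ≈[x-γ]²+c γ ⟩
    (γ - γ) * (γ - γ) + c    ≈⟨ +-congʳ (trans (*-congʳ (-‿inverseʳ γ)) (zeroˡ _)) ⟩
    0# + c                   ≈⟨ +-identityˡ c ⟩
    c                        ∎

  f-collision : ∀ {x y} → ¬ x ≈ y → f x ≈ f y → (x - γ) + (y - γ) ≈ 0#
  f-collision {x} {y} x≉y fx≈fy = x*x≈y*y⇒x+y≈0
    (λ x-γ≈y-γ → x≉y (+-cancelʳ (- γ) x y x-γ≈y-γ))
    (+-cancelʳ γ _ _ (+-cancelʳ c _ _ fx≈fy))

  preperiod-two : ∀ n → OrbitType F f γ 2 n → (b n - γ) * (b n - γ) ≈ - (two * c)
  preperiod-two n o@(0<n , collision , _) = x+[y+y]≈0⇒x≈-[two*y] (begin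
    s + (c + c)                 ≈⟨ solve 2 (λ s k → s :+ (k :+ k) := k :+ (s :+ k)) refl s c ⟩
    c + (s + c)                 ≈⟨ +-cong f[γ]-γ≈c (f[x]-γ≈[x-γ]²+c (b n)) ⟨
    (b 1 - γ) + (b (suc n) - γ) ≈⟨ f-collision (orbitType-noncollision o (s≤s (s≤s z≤n)) 0<n) collision ⟩
    0#                          ∎)
    where
    s : Carrier
    s = (b n - γ) * (b n - γ)

  preperiod-three-period-one : OrbitType F f γ 3 1 →
    ((b 1 - γ) * (b 1 - γ)) * ((b 2 - γ) * (b 2 - γ)) ≈ two * (b 2 - γ)
    × (b 1 - γ) * (b 1 - γ) + (b 2 - γ) * (b 2 - γ) ≈ - (two * c)
  preperiod-three-period-one o@(0<1 , collision , _) =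
    trans (*-cong (*-cong d₁≈c d₁≈c) (*-cong d₂≈e d₂≈e)) (trans product (*-congˡ (sym d₂≈e))) ,
    trans (+-cong (*-cong d₁≈c d₁≈c) (*-cong d₂≈e d₂≈e)) sum
    where
    e : Carrier
    e = c * c + c
    d₁≈c : b 1 - γ ≈ c
    d₁≈c = f[γ]-γ≈c
    d₂≈e : b 2 - γ ≈ e
    d₂≈e = trans (f[x]-γ≈[x-γ]²+c (b 1)) (+-congʳ (*-cong d₁≈c d₁≈c))
    S : e + (e * e + c) ≈ 0#
    S = begin
      e + (e * e + c)                         ≈⟨ +-cong d₂≈e (+-congʳ (*-cong d₂≈e d₂≈e)) ⟨
      (b 2 - γ) + ((b 2 - γ) * (b 2 - γ) + c) ≈⟨ +-congˡ (f[x]-γ≈[x-γ]²+c (b 2)) ⟨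
      (b 2 - γ) + (b 3 - γ)                   ≈⟨ f-collision (orbitType-noncollision o (s≤s (s≤s (s≤s z≤n))) 0<1) collision ⟩
      0#                                      ∎
    product : (c * c) * (e * e) ≈ two * e
    product = proj₁ (critical-relations c S)
    sum : c * c + e * e ≈ - (two * c)
    sum = proj₂ (critical-relations c S)

lemma3p3 : ∀ {a ℓ} (F : FiniteField a ℓ) → OddCharacteristic (FiniteField.fld F) →
    let open FiniteField F in
    (γ c : Carrier) →
    let f : Carrier → Carrier
        f x = (x - γ) * (x - γ) + γ + c
        b : ℕ → Carrier
        b i = iter fld f i γ
        two = 1# + 1#
    in ((n : ℕ) → OrbitType fld f γ 2 n →
          (b n - γ) * (b n - γ) ≈ - (two * c))
       ×
       (OrbitType fld f γ 3 1 →
          (((b 1 - γ) * (b 1 - γ)) * ((b 2 - γ) * (b 2 - γ)) ≈ two * (b 2 - γ))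
          × ((b 1 - γ) * (b 1 - γ) + (b 2 - γ) * (b 2 - γ) ≈ - (two * c)))
lemma3p3 F _ γ c = preperiod-two , preperiod-three-period-one
  where open CriticalOrbit (FiniteField.fld F) γ c
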